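{- Let $D$ be a dendriform algebra over a field $k$ of characteristic zero and $\overline D=D\oplus k\mathbf 1$ its unital augmentation. Let $b,c\in D$ and let $Y,Z\in\overline D[[\lambda]]$ satisfy $$Y=\mathbf 1+\lambda\, c\prec Y,\qquad Z=\mathbf 1+\lambda\, Z\succ b .$$ Then $X:=Y*Z$ satisfies $$X=\mathbf 1+\lambda\, X\succ b+\lambda\, c\prec X .$$
   Context: A dendriform algebra over $k$ is a $k$-vector space $D$ with bilinear operations $\prec,\succ$ such that for all $a,b,c\in D$: $(a\prec b)\prec c=a\prec(b\prec c+b\succ c)$, $(a\succ b)\prec c=a\succ(b\prec c)$, $a\succ(b\succ c)=(a\prec b+a\succ b)\succ c$. The product $a*b:=a\prec b+a\succ b$ is associative. The augmentation $\overline D=D\oplus k\mathbf 1$ is defined by $a\prec\mathbf 1=a=\mathbf 1\succ a$ and $\mathbf 1\prec a=0=a\succ\mathbf 1$ for $a\in D$ (the expressions $\mathbf 1\prec\mathbf 1$ and $\mathbf 1\succ\mathbf 1$ are left undefined), so that $a*\mathbf 1=\mathbf 1*a=a$ and $\mathbf 1*\mathbf 1=\mathbf 1$. All operations are extended $\lambda$-bilinearly to formal power series $\overline D[[\lambda]]$. -}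

module Defs where

open import Level using (_⊔_) renaming (suc to lsuc)
open import Data.Nat using (ℕ; zero; suc; _∸_)
open import Data.Product using (_×_; _,_; proj₁; proj₂; ∃)
open import Relation.Nullary using (¬_)
open import Relation.Binary.PropositionalEquality using (_≡_)
open import Algebra.Bundles using (CommutativeRing)
open import Algebra.Module.Bundles using (Module)

record Field c ℓ : Set (lsuc (c ⊔ ℓ)) where
  field
    commutativeRing : CommutativeRing c ℓ
  open CommutativeRing commutativeRing public
  field
    0≉1     : ¬ (0# ≈ 1#)
    inverse : ∀ x → ¬ (x ≈ 0#) → ∃ λ y → (x * y) ≈ 1#

  natCast : ℕ → Carrier
  natCast zero    = 0#
  natCast (suc n) = 1# + natCast n

CharZero : ∀ {c ℓ} → Field c ℓ → Set ℓ
CharZero K = ∀ n → Field.natCast K n ≈ Field.0# K → n ≡ 0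
  where open Field K using (_≈_)

record DendriformAlgebra {c ℓ} (K : Field c ℓ) m ℓm : Set (c ⊔ ℓ ⊔ lsuc (m ⊔ ℓm)) where
  open Field K using (commutativeRing) renaming (Carrier to k)
  field
    vectorSpace : Module commutativeRing m ℓm
  open Module vectorSpace public
  infixl 7 _≺_ _≻_ _✶_
  field
    _≺_ : Carrierᴹ → Carrierᴹ → Carrierᴹ
    _≻_ : Carrierᴹ → Carrierᴹ → Carrierᴹ
    ≺-cong : ∀ {a a′ b b′} → a ≈ᴹ a′ → b ≈ᴹ b′ → (a ≺ b) ≈ᴹ (a′ ≺ b′)
    ≻-cong : ∀ {a a′ b b′} → a ≈ᴹ a′ → b ≈ᴹ b′ → (a ≻ b) ≈ᴹ (a′ ≻ b′)
    ≺-distribʳ : ∀ a b x → ((a +ᴹ b) ≺ x) ≈ᴹ ((a ≺ x) +ᴹ (b ≺ x))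
    ≺-distribˡ : ∀ x a b → (x ≺ (a +ᴹ b)) ≈ᴹ ((x ≺ a) +ᴹ (x ≺ b))
    ≻-distribʳ : ∀ a b x → ((a +ᴹ b) ≻ x) ≈ᴹ ((a ≻ x) +ᴹ (b ≻ x))
    ≻-distribˡ : ∀ x a b → (x ≻ (a +ᴹ b)) ≈ᴹ ((x ≻ a) +ᴹ (x ≻ b))
    ≺-scalarˡ  : ∀ (α : k) a b → ((α *ₗ a) ≺ b) ≈ᴹ (α *ₗ (a ≺ b))
    ≺-scalarʳ  : ∀ (α : k) a b → (a ≺ (α *ₗ b)) ≈ᴹ (α *ₗ (a ≺ b))
    ≻-scalarˡ  : ∀ (α : k) a b → ((α *ₗ a) ≻ b) ≈ᴹ (α *ₗ (a ≻ b))
    ≻-scalarʳ  : ∀ (α : k) a b → (a ≻ (α *ₗ b)) ≈ᴹ (α *ₗ (a ≻ b))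
    dend₁ : ∀ a b c → ((a ≺ b) ≺ c) ≈ᴹ (a ≺ ((b ≺ c) +ᴹ (b ≻ c)))
    dend₂ : ∀ a b c → ((a ≻ b) ≺ c) ≈ᴹ (a ≻ (b ≺ c))
    dend₃ : ∀ a b c → (a ≻ (b ≻ c)) ≈ᴹ (((a ≺ b) +ᴹ (a ≻ b)) ≻ c)

  _✶_ : Carrierᴹ → Carrierᴹ → Carrierᴹ
  a ✶ b = (a ≺ b) +ᴹ (a ≻ b)

module Augmentation {c ℓ m ℓm} {K : Field c ℓ} (D : DendriformAlgebra K m ℓm) where
  open Field K using (_+_; _*_; 0#; 1#) renaming (Carrier to k; _≈_ to _≈k_)
  open DendriformAlgebra D

  -- an element (a , α) of D̄ stands for a + α𝟏
  D̄ : Set (c ⊔ m)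
  D̄ = Carrierᴹ × k

  infix 4 _≈̄_
  _≈̄_ : D̄ → D̄ → Set (ℓ ⊔ ℓm)
  (a , α) ≈̄ (b , β) = (a ≈ᴹ b) × (α ≈k β)

  ι : Carrierᴹ → D̄
  ι a = (a , 0#)

  𝟏 : D̄
  𝟏 = (0ᴹ , 1#)

  0̄ : D̄
  0̄ = (0ᴹ , 0#)

  _+̄_ : D̄ → D̄ → D̄
  (a , α) +̄ (b , β) = (a +ᴹ b , α + β)

  -- the (partially defined) augmented operations, on the domains where they are defined:
  -- a ≺ (y + β𝟏) = a ≺ y + β a     (a ∈ D, using a ≺ 𝟏 = a)
  _≺̄_ : Carrierᴹ → D̄ → D̄
  a ≺̄ (y , β) = ι ((a ≺ y) +ᴹ (β *ₗ a))

  -- (x + α𝟏) ≻ b = x ≻ b + α b     (b ∈ D, using 𝟏 ≻ b = b)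
  _≻̄_ : D̄ → Carrierᴹ → D̄
  (x , α) ≻̄ b = ι ((x ≻ b) +ᴹ (α *ₗ b))

  -- (x + α𝟏) * (y + β𝟏) = x * y + β x + α y + αβ𝟏
  _*̄_ : D̄ → D̄ → D̄
  (x , α) *̄ (y , β) = ((x ✶ y) +ᴹ ((β *ₗ x) +ᴹ (α *ₗ y)) , α * β)

  Σ̄ : (ℕ → D̄) → ℕ → D̄
  Σ̄ f zero    = f zero
  Σ̄ f (suc n) = Σ̄ f n +̄ f (suc n)

  Series : ∀ {a} → Set a → Set a
  Series A = ℕ → A

  infix 4 _≈S_
  _≈S_ : Series D̄ → Series D̄ → Set (ℓ ⊔ ℓm)
  f ≈S g = ∀ n → f n ≈̄ g n

  𝟏S : Series D̄
  𝟏S zero    = 𝟏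
  𝟏S (suc n) = 0̄

  constD : Carrierᴹ → Series Carrierᴹ
  constD a zero    = a
  constD a (suc n) = 0ᴹ

  infixr 5 _+S_
  infixl 7 _≺S_ _≻S_ _*S_
  _+S_ : Series D̄ → Series D̄ → Series D̄
  (f +S g) n = f n +̄ g n

  -- multiplication by the formal variable λ
  infix 6 λ·_
  λ·_ : Series D̄ → Series D̄
  (λ· f) zero    = 0̄
  (λ· f) (suc n) = f n

  -- λ-bilinear extension of a bilinear operation (Cauchy product)
  conv : ∀ {a b} {A : Set a} {B : Set b} → (A → B → D̄) → Series A → Series B → Series D̄
  conv _⊙_ f g n = Σ̄ (λ i → f i ⊙ g (n ∸ i)) n

  _≺S_ : Series Carrierᴹ → Series D̄ → Series D̄
  _≺S_ = conv _≺̄_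

  _≻S_ : Series D̄ → Series Carrierᴹ → Series D̄
  _≻S_ = conv _≻̄_

  _*S_ : Series D̄ → Series D̄ → Series D̄
  _*S_ = conv _*̄_

-- The recursions say Y₀ = Z₀ = 𝟏, Yᵢ₊₁ = c ≺ Yᵢ and Zⱼ₊₁ = Zⱼ ≻ b. For n ≥ 0 every
-- term Yᵢ * Zₙ₊₁₋ᵢ of Xₙ₊₁ has a factor without 𝟏-component, so it splits as
-- yᵢ ≺ Zₙ₊₁₋ᵢ + Yᵢ ≻ zₙ₊₁₋ᵢ (lower case: the D-component). The first sum loses its
-- i = 0 term and becomes Σ (c ≺ Yᵢ₋₁) ≺ Zₙ₊₁₋ᵢ = c ≺ Xₙ by the first dendriform
-- axiom; the second loses its i = n+1 term and becomes Σ Yᵢ ≻ (Zₙ₋ᵢ ≻ b) = Xₙ ≻ b by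
-- the third. Both axioms stay valid in the augmentation.
module Submission where

open import Data.Nat using (ℕ; zero; suc; _∸_; _≤_; z≤n; s≤s)
open import Data.Nat.Properties using (n∸n≡0; +-∸-assoc; m≤n⇒m≤1+n; ≤-refl)
open import Data.Product using (_,_; proj₁; proj₂)
open import Relation.Binary.PropositionalEquality using (_≡_; refl; cong; subst; sym)
open import Algebra.Bundles using (CommutativeMonoid)
import Algebra.Construct.DirectProduct as DirectProduct
import Algebra.Properties.CommutativeSemigroup as CommutativeSemigroupProperties
import Relation.Binary.Reasoning.Setoid as SetoidReasoning
open import Level using (_⊔_)
open import Defs

module _ {c ℓ m ℓm} {K : Field c ℓ} (D : DendriformAlgebra K m ℓm) where
  open Field K using (_*_; 0#; +-identityʳ; *-identityˡ; *-comm; zeroˡ; zeroʳ; +-commutativeMonoid)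
    renaming (_≈_ to _≈k_; refl to k-refl; sym to k-sym; trans to k-trans; *-cong to k*-cong)
  open DendriformAlgebra D
  open Augmentation D

  D̄-+-commutativeMonoid : CommutativeMonoid (c ⊔ m) (ℓ ⊔ ℓm)
  D̄-+-commutativeMonoid = DirectProduct.commutativeMonoid +ᴹ-commutativeMonoid +-commutativeMonoid

  open CommutativeMonoid D̄-+-commutativeMonoid using (setoid)
    renaming ( refl to ≈̄-refl; trans to ≈̄-trans; ∙-cong to +̄-cong
             ; assoc to +̄-assoc; comm to +̄-comm; identityˡ to +̄-identityˡ; identityʳ to +̄-identityʳ
             ; commutativeSemigroup to D̄-+-commutativeSemigroup )
  open CommutativeSemigroupProperties D̄-+-commutativeSemigroup using ()
    renaming (interchange to +̄-interchange)
  open CommutativeSemigroupProperties (CommutativeMonoid.commutativeSemigroup +ᴹ-commutativeMonoid) using ()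
    renaming (interchange to +ᴹ-interchange; x∙yz≈x∙zy to +ᴹ-swapʳ)

  +ᴹ-regroup : ∀ a b c e → ((a +ᴹ (b +ᴹ c)) +ᴹ e) ≈ᴹ ((a +ᴹ b) +ᴹ (c +ᴹ e))
  +ᴹ-regroup a b c e = ≈ᴹ-trans (+ᴹ-cong (≈ᴹ-sym (+ᴹ-assoc a b c)) ≈ᴹ-refl) (+ᴹ-assoc (a +ᴹ b) c e)

  ≺-zeroˡ : ∀ x → (0ᴹ ≺ x) ≈ᴹ 0ᴹ
  ≺-zeroˡ x = ≈ᴹ-trans (≺-cong (≈ᴹ-sym (*ₗ-zeroˡ 0ᴹ)) ≈ᴹ-refl)
                       (≈ᴹ-trans (≺-scalarˡ 0# 0ᴹ x) (*ₗ-zeroˡ _))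

  ≻-zeroˡ : ∀ x → (0ᴹ ≻ x) ≈ᴹ 0ᴹ
  ≻-zeroˡ x = ≈ᴹ-trans (≻-cong (≈ᴹ-sym (*ₗ-zeroˡ 0ᴹ)) ≈ᴹ-refl)
                       (≈ᴹ-trans (≻-scalarˡ 0# 0ᴹ x) (*ₗ-zeroˡ _))

  ≻-zeroʳ : ∀ x → (x ≻ 0ᴹ) ≈ᴹ 0ᴹ
  ≻-zeroʳ x = ≈ᴹ-trans (≻-cong ≈ᴹ-refl (≈ᴹ-sym (*ₗ-zeroˡ 0ᴹ)))
                       (≈ᴹ-trans (≻-scalarʳ 0# x 0ᴹ) (*ₗ-zeroˡ _))

  ≺̄-cong : ∀ {x x′ W W′} → x ≈ᴹ x′ → W ≈̄ W′ → x ≺̄ W ≈̄ x′ ≺̄ W′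
  ≺̄-cong x≈x′ (w≈w′ , β≈β′) = +ᴹ-cong (≺-cong x≈x′ w≈w′) (*ₗ-cong β≈β′ x≈x′) , k-refl

  ≻̄-cong : ∀ {U U′ x x′} → U ≈̄ U′ → x ≈ᴹ x′ → U ≻̄ x ≈̄ U′ ≻̄ x′
  ≻̄-cong (u≈u′ , α≈α′) x≈x′ = +ᴹ-cong (≻-cong u≈u′ x≈x′) (*ₗ-cong α≈α′ x≈x′) , k-refl

  *̄-cong : ∀ {U U′ W W′} → U ≈̄ U′ → W ≈̄ W′ → U *̄ W ≈̄ U′ *̄ W′
  *̄-cong (u≈u′ , α≈α′) (w≈w′ , β≈β′) =
    +ᴹ-cong (+ᴹ-cong (≺-cong u≈u′ w≈w′) (≻-cong u≈u′ w≈w′))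
            (+ᴹ-cong (*ₗ-cong β≈β′ u≈u′) (*ₗ-cong α≈α′ w≈w′)) ,
    k*-cong α≈α′ β≈β′

  ≺̄-zeroˡ : ∀ W → 0ᴹ ≺̄ W ≈̄ 0̄
  ≺̄-zeroˡ (w , β) = ≈ᴹ-trans (+ᴹ-cong (≺-zeroˡ w) (*ₗ-zeroʳ β)) (+ᴹ-identityˡ 0ᴹ) , k-refl

  ≻̄-zeroʳ : ∀ U → U ≻̄ 0ᴹ ≈̄ 0̄
  ≻̄-zeroʳ (u , α) = ≈ᴹ-trans (+ᴹ-cong (≻-zeroʳ u) (*ₗ-zeroʳ α)) (+ᴹ-identityˡ 0ᴹ) , k-refl

  ≺̄-distribˡ : ∀ x U V → x ≺̄ (U +̄ V) ≈̄ (x ≺̄ U) +̄ (x ≺̄ V)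
  ≺̄-distribˡ x (u , α) (v , β) =
    ≈ᴹ-trans (+ᴹ-cong (≺-distribˡ x u v) (*ₗ-distribʳ x α β)) (+ᴹ-interchange _ _ _ _) ,
    k-sym (+-identityʳ 0#)

  ≻̄-distribʳ : ∀ x U V → (U +̄ V) ≻̄ x ≈̄ (U ≻̄ x) +̄ (V ≻̄ x)
  ≻̄-distribʳ x (u , α) (v , β) =
    ≈ᴹ-trans (+ᴹ-cong (≻-distribʳ u v x) (*ₗ-distribʳ x α β)) (+ᴹ-interchange _ _ _ _) ,
    k-sym (+-identityʳ 0#)

  *̄-identityˡ : ∀ W → 𝟏 *̄ W ≈̄ W
  *̄-identityˡ (w , β) =
    ≈ᴹ-trans (+ᴹ-cong (≈ᴹ-trans (+ᴹ-cong (≺-zeroˡ w) (≻-zeroˡ w)) (+ᴹ-identityˡ 0ᴹ))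
                      (≈ᴹ-trans (+ᴹ-cong (*ₗ-zeroʳ β) (*ₗ-identityˡ w)) (+ᴹ-identityˡ w)))
             (+ᴹ-identityˡ w) ,
    *-identityˡ β

  *̄-split : ∀ U W → proj₂ U * proj₂ W ≈k 0# → U *̄ W ≈̄ (proj₁ U ≺̄ W) +̄ (U ≻̄ proj₁ W)
  *̄-split (u , α) (w , β) αβ≈0 = +ᴹ-interchange _ _ _ _ , k-trans αβ≈0 (k-sym (+-identityʳ 0#))

  dend₁-augmented : ∀ x U W → x ≺̄ (U *̄ W) ≈̄ proj₁ (x ≺̄ U) ≺̄ W
  dend₁-augmented x (u , α) (w , β) = proof , k-refl
    where
    open SetoidReasoning ≈ᴹ-setoid
    proof : (x ≺ ((u ✶ w) +ᴹ ((β *ₗ u) +ᴹ (α *ₗ w)))) +ᴹ ((α * β) *ₗ x)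
            ≈ᴹ (((x ≺ u) +ᴹ (α *ₗ x)) ≺ w) +ᴹ (β *ₗ ((x ≺ u) +ᴹ (α *ₗ x)))
    proof = begin
      (x ≺ ((u ✶ w) +ᴹ ((β *ₗ u) +ᴹ (α *ₗ w)))) +ᴹ ((α * β) *ₗ x)
        ≈⟨ +ᴹ-cong (≈ᴹ-trans (≺-distribˡ x _ _) (+ᴹ-cong ≈ᴹ-refl (≺-distribˡ x _ _)))
                   (≈ᴹ-trans (*ₗ-cong (*-comm α β) ≈ᴹ-refl) (*ₗ-assoc β α x)) ⟩
      ((x ≺ (u ✶ w)) +ᴹ ((x ≺ (β *ₗ u)) +ᴹ (x ≺ (α *ₗ w)))) +ᴹ (β *ₗ (α *ₗ x))
        ≈⟨ +ᴹ-cong (+ᴹ-cong (≈ᴹ-sym (dend₁ x u w)) (+ᴹ-cong (≺-scalarʳ β x u) (≺-scalarʳ α x w))) ≈ᴹ-refl ⟩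
      (((x ≺ u) ≺ w) +ᴹ ((β *ₗ (x ≺ u)) +ᴹ (α *ₗ (x ≺ w)))) +ᴹ (β *ₗ (α *ₗ x))
        ≈⟨ +ᴹ-cong (+ᴹ-swapʳ _ _ _) ≈ᴹ-refl ⟩
      (((x ≺ u) ≺ w) +ᴹ ((α *ₗ (x ≺ w)) +ᴹ (β *ₗ (x ≺ u)))) +ᴹ (β *ₗ (α *ₗ x))
        ≈⟨ +ᴹ-regroup _ _ _ _ ⟩
      (((x ≺ u) ≺ w) +ᴹ (α *ₗ (x ≺ w))) +ᴹ ((β *ₗ (x ≺ u)) +ᴹ (β *ₗ (α *ₗ x)))
        ≈⟨ ≈ᴹ-sym (+ᴹ-cong (≈ᴹ-trans (≺-distribʳ _ _ w) (+ᴹ-cong ≈ᴹ-refl (≺-scalarˡ α x w)))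
                           (*ₗ-distribˡ β _ _)) ⟩
      (((x ≺ u) +ᴹ (α *ₗ x)) ≺ w) +ᴹ (β *ₗ ((x ≺ u) +ᴹ (α *ₗ x))) ∎

  dend₃-augmented : ∀ x U W → (U *̄ W) ≻̄ x ≈̄ U ≻̄ proj₁ (W ≻̄ x)
  dend₃-augmented x (u , α) (w , β) = proof , k-refl
    where
    open SetoidReasoning ≈ᴹ-setoid
    proof : (((u ✶ w) +ᴹ ((β *ₗ u) +ᴹ (α *ₗ w))) ≻ x) +ᴹ ((α * β) *ₗ x)
            ≈ᴹ (u ≻ ((w ≻ x) +ᴹ (β *ₗ x))) +ᴹ (α *ₗ ((w ≻ x) +ᴹ (β *ₗ x)))
    proof = begin
      (((u ✶ w) +ᴹ ((β *ₗ u) +ᴹ (α *ₗ w))) ≻ x) +ᴹ ((α * β) *ₗ x)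
        ≈⟨ +ᴹ-cong (≈ᴹ-trans (≻-distribʳ _ _ x) (+ᴹ-cong ≈ᴹ-refl (≻-distribʳ _ _ x))) (*ₗ-assoc α β x) ⟩
      (((u ✶ w) ≻ x) +ᴹ (((β *ₗ u) ≻ x) +ᴹ ((α *ₗ w) ≻ x))) +ᴹ (α *ₗ (β *ₗ x))
        ≈⟨ +ᴹ-cong (+ᴹ-cong (≈ᴹ-sym (dend₃ u w x)) (+ᴹ-cong (≻-scalarˡ β u x) (≻-scalarˡ α w x))) ≈ᴹ-refl ⟩
      ((u ≻ (w ≻ x)) +ᴹ ((β *ₗ (u ≻ x)) +ᴹ (α *ₗ (w ≻ x)))) +ᴹ (α *ₗ (β *ₗ x))
        ≈⟨ +ᴹ-regroup _ _ _ _ ⟩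
      ((u ≻ (w ≻ x)) +ᴹ (β *ₗ (u ≻ x))) +ᴹ ((α *ₗ (w ≻ x)) +ᴹ (α *ₗ (β *ₗ x)))
        ≈⟨ ≈ᴹ-sym (+ᴹ-cong (≈ᴹ-trans (≻-distribˡ u _ _) (+ᴹ-cong ≈ᴹ-refl (≻-scalarʳ β u x)))
                           (*ₗ-distribˡ α _ _)) ⟩
      (u ≻ ((w ≻ x) +ᴹ (β *ₗ x))) +ᴹ (α *ₗ ((w ≻ x) +ᴹ (β *ₗ x))) ∎

  Σ̄-cong≤ : ∀ {f g} n → (∀ i → i ≤ n → f i ≈̄ g i) → Σ̄ f n ≈̄ Σ̄ g n
  Σ̄-cong≤ zero    f≈g = f≈g 0 z≤n
  Σ̄-cong≤ (suc n) f≈g = +̄-cong (Σ̄-cong≤ n (λ i i≤n → f≈g i (m≤n⇒m≤1+n i≤n))) (f≈g (suc n) ≤-refl)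

  Σ̄-cong : ∀ {f g} n → (∀ i → f i ≈̄ g i) → Σ̄ f n ≈̄ Σ̄ g n
  Σ̄-cong n f≈g = Σ̄-cong≤ n (λ i _ → f≈g i)

  Σ̄-zero≤ : ∀ {f} n → (∀ i → i ≤ n → f i ≈̄ 0̄) → Σ̄ f n ≈̄ 0̄
  Σ̄-zero≤ zero    f≈0 = f≈0 0 z≤n
  Σ̄-zero≤ (suc n) f≈0 =
    ≈̄-trans (+̄-cong (Σ̄-zero≤ n (λ i i≤n → f≈0 i (m≤n⇒m≤1+n i≤n))) (f≈0 (suc n) ≤-refl)) (+̄-identityˡ 0̄)

  Σ̄-+ : ∀ f g n → Σ̄ (λ i → f i +̄ g i) n ≈̄ Σ̄ f n +̄ Σ̄ g n
  Σ̄-+ f g zero    = ≈̄-refl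
  Σ̄-+ f g (suc n) = ≈̄-trans (+̄-cong (Σ̄-+ f g n) ≈̄-refl) (+̄-interchange _ _ _ _)

  Σ̄-suc : ∀ f n → Σ̄ f (suc n) ≈̄ f 0 +̄ Σ̄ (λ i → f (suc i)) n
  Σ̄-suc f zero    = ≈̄-refl
  Σ̄-suc f (suc n) = ≈̄-trans (+̄-cong (Σ̄-suc f n) ≈̄-refl) (+̄-assoc _ _ _)

  Σ̄-head : ∀ f n → (∀ i → f (suc i) ≈̄ 0̄) → Σ̄ f n ≈̄ f 0
  Σ̄-head f zero    _    = ≈̄-refl
  Σ̄-head f (suc n) f≈0 =
    ≈̄-trans (Σ̄-suc f n) (≈̄-trans (+̄-cong ≈̄-refl (Σ̄-zero≤ n (λ i _ → f≈0 i))) (+̄-identityʳ _))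

  Σ̄-homomorphic : (h : D̄ → D̄) → (∀ u v → h (u +̄ v) ≈̄ h u +̄ h v) →
                  ∀ f n → h (Σ̄ f n) ≈̄ Σ̄ (λ i → h (f i)) n
  Σ̄-homomorphic h h-+ f zero    = ≈̄-refl
  Σ̄-homomorphic h h-+ f (suc n) = ≈̄-trans (h-+ _ _) (+̄-cong (Σ̄-homomorphic h h-+ f n) ≈̄-refl)

  constD-suc∸ : ∀ x {n i} → i ≤ n → constD x (suc n ∸ i) ≡ 0ᴹ
  constD-suc∸ x {i = zero}  _         = refl
  constD-suc∸ x {i = suc i} (s≤s i≤n) = constD-suc∸ x i≤n

  ≻S-constD : ∀ f x n → (f ≻S constD x) n ≈̄ f n ≻̄ x
  ≻S-constD f x zero    = ≈̄-refl
  ≻S-constD f x (suc n) =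
    ≈̄-trans (+̄-cong (Σ̄-zero≤ n (λ i i≤n → ≈̄-trans (≻̄-cong ≈̄-refl (≈ᴹ-reflexive (constD-suc∸ x i≤n)))
                                                   (≻̄-zeroʳ _)))
                     (≻̄-cong ≈̄-refl (≈ᴹ-reflexive (cong (constD x) (n∸n≡0 n)))))
            (+̄-identityˡ _)

  constD-≺S : ∀ x f n → (constD x ≺S f) n ≈̄ x ≺̄ f n
  constD-≺S x f n = Σ̄-head _ n (λ i → ≺̄-zeroˡ _)

  ≈𝟏S+λ·-zero : ∀ {Y T} → Y ≈S 𝟏S +S λ· T → Y 0 ≈̄ 𝟏
  ≈𝟏S+λ·-zero Y≈ = ≈̄-trans (Y≈ 0) (+̄-identityʳ 𝟏)

  ≈𝟏S+λ·-suc : ∀ {Y T} → Y ≈S 𝟏S +S λ· T → ∀ i → Y (suc i) ≈̄ T i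
  ≈𝟏S+λ·-suc Y≈ i = ≈̄-trans (Y≈ (suc i)) (+̄-identityˡ _)

  ≺-solution-suc : ∀ {x Y} → Y ≈S 𝟏S +S λ· (constD x ≺S Y) → ∀ i → Y (suc i) ≈̄ x ≺̄ Y i
  ≺-solution-suc {x} {Y} Y≈ i = ≈̄-trans (≈𝟏S+λ·-suc Y≈ i) (constD-≺S x Y i)

  ≻-solution-suc : ∀ {x Z} → Z ≈S 𝟏S +S λ· (Z ≻S constD x) → ∀ j → Z (suc j) ≈̄ Z j ≻̄ x
  ≻-solution-suc {x} {Z} Z≈ j = ≈̄-trans (≈𝟏S+λ·-suc Z≈ j) (≻S-constD Z x j)

  module _ (b c : Carrierᴹ) (Y Z : Series D̄)
           (Y-zero : Y 0 ≈̄ 𝟏) (Y-suc : ∀ i → Y (suc i) ≈̄ c ≺̄ Y i)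
           (Z-zero : Z 0 ≈̄ 𝟏) (Z-suc : ∀ j → Z (suc j) ≈̄ Z j ≻̄ b) where
    open SetoidReasoning setoid

    *S-suc-split : ∀ n i → Y i *̄ Z (suc n ∸ i) ≈̄ (proj₁ (Y i) ≺̄ Z (suc n ∸ i)) +̄ (Y i ≻̄ proj₁ (Z (suc n ∸ i)))
    *S-suc-split n zero    = *̄-split _ _ (k-trans (k*-cong k-refl (proj₂ (Z-suc n))) (zeroʳ _))
    *S-suc-split n (suc i) = *̄-split _ _ (k-trans (k*-cong (proj₂ (Y-suc i)) k-refl) (zeroˡ _))

    Σ̄-≺̄-part : ∀ n → Σ̄ (λ i → proj₁ (Y i) ≺̄ Z (suc n ∸ i)) (suc n) ≈̄ c ≺̄ (Y *S Z) n
    Σ̄-≺̄-part n = begin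
      Σ̄ (λ i → proj₁ (Y i) ≺̄ Z (suc n ∸ i)) (suc n)
        ≈⟨ Σ̄-suc _ n ⟩
      (proj₁ (Y 0) ≺̄ Z (suc n)) +̄ Σ̄ (λ i → proj₁ (Y (suc i)) ≺̄ Z (n ∸ i)) n
        ≈⟨ +̄-cong (≈̄-trans (≺̄-cong (proj₁ Y-zero) ≈̄-refl) (≺̄-zeroˡ _))
                  (Σ̄-cong n (λ i → ≺̄-cong (proj₁ (Y-suc i)) ≈̄-refl)) ⟩
      0̄ +̄ Σ̄ (λ i → proj₁ (c ≺̄ Y i) ≺̄ Z (n ∸ i)) n
        ≈⟨ +̄-identityˡ _ ⟩
      Σ̄ (λ i → proj₁ (c ≺̄ Y i) ≺̄ Z (n ∸ i)) n
        ≈⟨ Σ̄-cong n (λ i → dend₁-augmented c (Y i) (Z (n ∸ i))) ⟨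
      Σ̄ (λ i → c ≺̄ (Y i *̄ Z (n ∸ i))) n
        ≈⟨ Σ̄-homomorphic (c ≺̄_) (≺̄-distribˡ c) _ n ⟨
      c ≺̄ (Y *S Z) n ∎

    Z-suc∸ : ∀ {n i} → i ≤ n → Z (suc n ∸ i) ≈̄ Z (n ∸ i) ≻̄ b
    Z-suc∸ {n} {i} i≤n = subst (λ j → Z j ≈̄ Z (n ∸ i) ≻̄ b) (sym (+-∸-assoc 1 i≤n)) (Z-suc (n ∸ i))

    Σ̄-≻̄-part : ∀ n → Σ̄ (λ i → Y i ≻̄ proj₁ (Z (suc n ∸ i))) (suc n) ≈̄ (Y *S Z) n ≻̄ b
    Σ̄-≻̄-part n = begin
      Σ̄ (λ i → Y i ≻̄ proj₁ (Z (suc n ∸ i))) n +̄ (Y (suc n) ≻̄ proj₁ (Z (n ∸ n)))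
        ≈⟨ +̄-cong (Σ̄-cong≤ n (λ i i≤n → ≻̄-cong ≈̄-refl (proj₁ (Z-suc∸ i≤n))))
                  (≈̄-trans (≻̄-cong ≈̄-refl (proj₁ Z-n∸n)) (≻̄-zeroʳ _)) ⟩
      Σ̄ (λ i → Y i ≻̄ proj₁ (Z (n ∸ i) ≻̄ b)) n +̄ 0̄
        ≈⟨ +̄-identityʳ _ ⟩
      Σ̄ (λ i → Y i ≻̄ proj₁ (Z (n ∸ i) ≻̄ b)) n
        ≈⟨ Σ̄-cong n (λ i → dend₃-augmented b (Y i) (Z (n ∸ i))) ⟨
      Σ̄ (λ i → (Y i *̄ Z (n ∸ i)) ≻̄ b) n
        ≈⟨ Σ̄-homomorphic (_≻̄ b) (≻̄-distribʳ b) _ n ⟨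
      (Y *S Z) n ≻̄ b ∎
      where
      Z-n∸n : Z (n ∸ n) ≈̄ 𝟏
      Z-n∸n = subst (λ j → Z j ≈̄ 𝟏) (sym (n∸n≡0 n)) Z-zero

    *S-recursion : (Y *S Z) ≈S 𝟏S +S (λ· ((Y *S Z) ≻S constD b) +S λ· (constD c ≺S (Y *S Z)))
    *S-recursion zero = begin
      Y 0 *̄ Z 0        ≈⟨ *̄-cong Y-zero Z-zero ⟩
      𝟏 *̄ 𝟏            ≈⟨ *̄-identityˡ 𝟏 ⟩
      𝟏                ≈⟨ +̄-identityʳ 𝟏 ⟨
      𝟏 +̄ 0̄           ≈⟨ +̄-cong ≈̄-refl (+̄-identityʳ 0̄) ⟨
      𝟏 +̄ (0̄ +̄ 0̄)   ∎
    *S-recursion (suc n) = begin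
      (Y *S Z) (suc n)
        ≈⟨ Σ̄-cong (suc n) (*S-suc-split n) ⟩
      Σ̄ (λ i → ≺̄-term i +̄ ≻̄-term i) (suc n)
        ≈⟨ Σ̄-+ ≺̄-term ≻̄-term (suc n) ⟩
      Σ̄ ≺̄-term (suc n) +̄ Σ̄ ≻̄-term (suc n)
        ≈⟨ +̄-cong (Σ̄-≺̄-part n) (Σ̄-≻̄-part n) ⟩
      (c ≺̄ (Y *S Z) n) +̄ ((Y *S Z) n ≻̄ b)
        ≈⟨ +̄-comm _ _ ⟩
      ((Y *S Z) n ≻̄ b) +̄ (c ≺̄ (Y *S Z) n)
        ≈⟨ +̄-cong (≻S-constD (Y *S Z) b n) (constD-≺S c (Y *S Z) n) ⟨
      ((Y *S Z) ≻S constD b) n +̄ (constD c ≺S (Y *S Z)) n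
        ≈⟨ +̄-identityˡ _ ⟨
      0̄ +̄ (((Y *S Z) ≻S constD b) n +̄ (constD c ≺S (Y *S Z)) n) ∎
      where
      ≺̄-term ≻̄-term : ℕ → D̄
      ≺̄-term i = proj₁ (Y i) ≺̄ Z (suc n ∸ i)
      ≻̄-term i = Y i ≻̄ proj₁ (Z (suc n ∸ i))

mainTheorem1 : ∀ {c ℓ m ℓm} (K : Field c ℓ) → CharZero K →
  (D : DendriformAlgebra K m ℓm) →
  let open DendriformAlgebra D using (Carrierᴹ)
      open Augmentation D
  in (b c : Carrierᴹ) (Y Z : Series D̄) →
     Y ≈S 𝟏S +S λ· (constD c ≺S Y) →
     Z ≈S 𝟏S +S λ· (Z ≻S constD b) →
     (Y *S Z) ≈S 𝟏S +S (λ· ((Y *S Z) ≻S constD b) +S λ· (constD c ≺S (Y *S Z)))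
mainTheorem1 K _ D b c Y Z Y≈ Z≈ =
  *S-recursion D b c Y Z (≈𝟏S+λ·-zero D Y≈) (≺-solution-suc D Y≈) (≈𝟏S+λ·-zero D Z≈) (≻-solution-suc D Z≈)
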